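{- For every graph $G$, every partition sequence $(\mathcal P_i)_{i\in[n]}$ of $G$ of width at most $1$, every $i\in[n]$ and every two distinct parts $P,Q\in\mathcal P_i$, the bipartite graph $G[P,Q]$ is a partial half-graph.
   Context: All graphs are finite and simple; $n=|V(G)|$. For disjoint $P,Q\subseteq V(G)$, $G[P,Q]$ is the bipartite graph with sides $P$ and $Q$ whose edges are the edges of $G$ between $P$ and $Q$. The half-graph $H_k$ has vertices $v_1,\dots,v_k,w_1,\dots,w_k$ with $v_iw_j$ an edge iff $i\le j$. A bipartite graph with sides $A,B$ is a partial half-graph if for some $k$ there are injections $\alpha:A\to\{v_1,\dots,v_k\}$ and $\beta:B\to\{w_1,\dots,w_k\}$ such that $ab$ is an edge iff $\alpha(a)\beta(b)$ is an edge of $H_k$ (i.e., it is an induced subgraph of a half-graph, sides respected; the side orientation is immaterial since $H_k$ is symmetric under swapping sides and reversing indices). Partition sequences: for a partition $\mathcal P$ of $V(G)$, the quotient trigraph $G/\mathcal P$ has a black edge between fully adjacent parts, no edge between parts with no edges between them, and a red edge otherwise; a partition sequence $\mathcal P_n,\dots,\mathcal P_1$ starts with singletons and merges two parts per step; its width is the maximum red degree over all $G/\mathcal P_i$. -}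

module Defs where

open import Data.Nat using (ℕ; zero; suc; _≤_; _∸_)
open import Data.Fin using (Fin) renaming (_≤_ to _≤ᶠ_)
open import Data.Bool using (Bool; true; false)
open import Data.Product using (Σ; ∃; _×_; _,_)
open import Data.Sum using (_⊎_)
open import Relation.Binary.PropositionalEquality using (_≡_; _≢_)
open import Function.Bundles using (_⇔_)

record Graph (n : ℕ) : Set where
  field
    adj   : Fin n → Fin n → Bool
    sym   : ∀ u v → adj u v ≡ adj v u
    irrefl : ∀ u → adj u u ≡ false
open Graph public

-- A partition of V into exactly m parts, represented by a surjective
-- labelling  V → Fin m  (part X = preimage of label X).
IsPartition : {n : ℕ} (m : ℕ) → (Fin n → Fin m) → Set
IsPartition m p = ∀ (X : Fin m) → ∃ λ u → p u ≡ X

-- Quotient trigraph G/P: distinct parts X, Y are joined by a red edge iff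
-- there is both an edge and a non-edge of G between X and Y.
RedEdge : {n m : ℕ} → Graph n → (Fin n → Fin m) → Fin m → Fin m → Set
RedEdge {n} G p X Y =
  X ≢ Y ×
  (Σ (Fin n) λ u → Σ (Fin n) λ v → p u ≡ X × p v ≡ Y × adj G u v ≡ true) ×
  (Σ (Fin n) λ u → Σ (Fin n) λ v → p u ≡ X × p v ≡ Y × adj G u v ≡ false)

RedDegreeAtMostOne : {n m : ℕ} → Graph n → (Fin n → Fin m) → Set
RedDegreeAtMostOne {m = m} G p =
  ∀ (X Y Z : Fin m) → RedEdge G p X Y → RedEdge G p X Z → Y ≡ Z

MergeOf : {n m : ℕ} → (Fin n → Fin (suc m)) → (Fin n → Fin m) → Set
MergeOf {n} {m} p q =
  Σ (Fin (suc m)) λ a → Σ (Fin (suc m)) λ b → a ≢ b ×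
    (∀ (u v : Fin n) →
      (q u ≡ q v) ⇔ (p u ≡ p v ⊎ (p u ≡ a × p v ≡ b) ⊎ (p u ≡ b × p v ≡ a)))

-- A partition sequence P_n, ..., P_1 of G.  'part i' is the labelling of
-- P_{i+1}, which has i+1 parts; only indices i < n are meaningful.
record PartitionSequence {n : ℕ} (G : Graph n) : Set where
  field
    part       : (i : ℕ) → Fin n → Fin (suc i)
    isPartition : ∀ i → suc i ≤ n → IsPartition (suc i) (part i)
    singletons : ∀ (u v : Fin n) → part (n ∸ 1) u ≡ part (n ∸ 1) v → u ≡ v
    merges     : ∀ i → suc (suc i) ≤ n → MergeOf (part (suc i)) (part i)
open PartitionSequence public

WidthAtMostOne : {n : ℕ} {G : Graph n} → PartitionSequence G → Set
WidthAtMostOne {n} {G} S = ∀ i → suc i ≤ n → RedDegreeAtMostOne G (part S i)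

-- G[A,B] (A, B disjoint vertex sets given as predicates) is a partial
-- half-graph: injections α : A → {v_1..v_k}, β : B → {w_1..w_k} with
-- ab ∈ E(G) iff α(a) ≤ β(b)  (the edge rule of H_k).
PartialHalfGraph : {n : ℕ} → Graph n → (Fin n → Set) → (Fin n → Set) → Set
PartialHalfGraph {n} G A B =
  Σ ℕ λ k → Σ (Fin n → Fin k) λ α → Σ (Fin n → Fin k) λ β →
    (∀ a a' → A a → A a' → α a ≡ α a' → a ≡ a') ×
    (∀ b b' → B b → B b' → β b ≡ β b' → b ≡ b') ×
    (∀ a b → A a → B b → (adj G a b ≡ true) ⇔ (α a ≤ᶠ β b))

{-# OPTIONS --safe #-}
-- Going backwards along the partition sequence, we show that any two parts of every P_i
-- induce a chain graph: there are thresholds s, t with ab ∈ E(G) iff s(a) ≤ t(b).  When parts A and B are merged, any other part Y has red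
-- degree at most 1, so it is homogeneous (complete or anticomplete) to A or to B, say to B;
-- then B can be added to the chain graph G[A,Y] below, respectively above, all of Y's
-- thresholds.  Breaking ties between thresholds finally yields a partial half-graph.
module Submission where

open import Defs hiding (sym)
open import Data.Nat using (ℕ; suc; _≤_)
open import Data.Fin using (Fin)
open import Relation.Binary.PropositionalEquality using (_≡_; _≢_)

open import Level using (0ℓ)
open import Data.Bool using (Bool; true; false; if_then_else_)
open import Data.Bool.Properties using () renaming (_≟_ to _≟ᵇ_)
open import Data.Empty using (⊥-elim)
open import Data.Fin using (zero; suc; toℕ; combine; opposite)
  renaming (_≤_ to _≤ᶠ_; _<_ to _<ᶠ_)
open import Data.Fin.Properties using (any?; toℕ-combine; combine-monoˡ-<; combine-injectiveʳ;
  opposite-prop; opposite-involutive) renaming (_≟_ to _≟ᶠ_)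
import Data.Nat as ℕ
import Data.Nat.Properties as ℕ
open import Data.Product using (Σ; _×_; _,_)
open import Data.Sum using (_⊎_; inj₁; inj₂)
import Data.Sum as Sum
open import Function using (_∘_; id)
open import Function.Bundles using (_⇔_; mk⇔; Equivalence)
import Function.Properties.Equivalence as ⇔
open import Relation.Binary.PropositionalEquality using (refl; sym; trans; subst₂)
open import Relation.Nullary using (Dec; yes; no; ¬_; ¬?; does; _×-dec_; _⊎-dec_)
open import Relation.Unary using (Pred; Decidable; _⊆_; _∪_; ｛_｝)

open Equivalence using (to; from)

opposite-antimono-≤ : ∀ {k} {i j : Fin k} → i ≤ᶠ j → opposite j ≤ᶠ opposite i
opposite-antimono-≤ {k} {i} {j} i≤j = begin
  toℕ (opposite j)  ≡⟨ opposite-prop j ⟩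
  k ℕ.∸ suc (toℕ j) ≤⟨ ℕ.∸-monoʳ-≤ k (ℕ.s≤s i≤j) ⟩
  k ℕ.∸ suc (toℕ i) ≡⟨ opposite-prop i ⟨
  toℕ (opposite i)  ∎
  where open ℕ.≤-Reasoning

≤⇔opposite-≥ : ∀ {k} {i j : Fin k} → i ≤ᶠ j ⇔ opposite j ≤ᶠ opposite i
≤⇔opposite-≥ {i = i} {j} = mk⇔ opposite-antimono-≤ λ h →
  subst₂ _≤ᶠ_ (opposite-involutive i) (opposite-involutive j) (opposite-antimono-≤ h)

-- Codes ordered lexicographically by (threshold, side, vertex): the side bit puts a left
-- vertex before a right vertex of equal threshold, and the vertex makes each side injective.
leftSide rightSide : Fin 2
leftSide  = zero
rightSide = suc zero

leftCode rightCode : ∀ {k n} → Fin k → Fin n → Fin (k ℕ.* 2 ℕ.* n)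
leftCode  i u = combine (combine i leftSide) u
rightCode j v = combine (combine j rightSide) v

leftCode-injectiveʳ : ∀ {k n} {i j : Fin k} {u v : Fin n} → leftCode i u ≡ leftCode j v → u ≡ v
leftCode-injectiveʳ {i = i} {j} {u} {v} =
  combine-injectiveʳ (combine i leftSide) u (combine j leftSide) v

rightCode-injectiveʳ : ∀ {k n} {i j : Fin k} {u v : Fin n} → rightCode i u ≡ rightCode j v → u ≡ v
rightCode-injectiveʳ {i = i} {j} {u} {v} =
  combine-injectiveʳ (combine i rightSide) u (combine j rightSide) v

combine-side-< : ∀ {k} {i j : Fin k} → i ≤ᶠ j → combine i leftSide <ᶠ combine j rightSide
combine-side-< {i = i} {j} i≤j = begin-strict
  toℕ (combine i leftSide)   ≡⟨ toℕ-combine i leftSide ⟩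
  2 ℕ.* toℕ i ℕ.+ 0          ≤⟨ ℕ.+-monoˡ-≤ 0 (ℕ.*-monoʳ-≤ 2 i≤j) ⟩
  2 ℕ.* toℕ j ℕ.+ 0          <⟨ ℕ.+-monoʳ-< (2 ℕ.* toℕ j) ℕ.z<s ⟩
  2 ℕ.* toℕ j ℕ.+ 1          ≡⟨ toℕ-combine j rightSide ⟨
  toℕ (combine j rightSide)  ∎
  where open ℕ.≤-Reasoning

≤⇔leftCode≤rightCode : ∀ {k n} {i j : Fin k} (u v : Fin n) → i ≤ᶠ j ⇔ leftCode i u ≤ᶠ rightCode j v
≤⇔leftCode≤rightCode u v = mk⇔
  (λ i≤j → ℕ.<⇒≤ (combine-monoˡ-< u v (combine-side-< i≤j)))
  (λ h → ℕ.≮⇒≥ λ j<i → ℕ.<⇒≱ (combine-monoˡ-< v u (combine-monoˡ-< rightSide leftSide j<i)) h)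

module _ {n : ℕ} (G : Graph n) where

  -- The threshold presentation of a chain graph: a partial half-graph in which ties are allowed.
  ChainGraph : Pred (Fin n) 0ℓ → Pred (Fin n) 0ℓ → Set
  ChainGraph A B = Σ ℕ λ k → Σ (Fin n → Fin k) λ s → Σ (Fin n → Fin k) λ t →
    ∀ {a b} → A a → B b → (adj G a b ≡ true) ⇔ (s a ≤ᶠ t b)

  Homogeneous : Bool → Pred (Fin n) 0ℓ → Pred (Fin n) 0ℓ → Set
  Homogeneous c A B = ∀ {a b} → A a → B b → adj G a b ≡ c

  Homogeneous-sym : ∀ {c A B} → Homogeneous c A B → Homogeneous c B A
  Homogeneous-sym hom b∈B a∈A = trans (Graph.sym G _ _) (hom a∈A b∈B)

  ChainGraph-⊆ : ∀ {A A′ B B′} → A′ ⊆ A → B′ ⊆ B → ChainGraph A B → ChainGraph A′ B′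
  ChainGraph-⊆ A′⊆A B′⊆B (k , s , t , rep) = k , s , t , λ a∈A′ b∈B′ → rep (A′⊆A a∈A′) (B′⊆B b∈B′)

  ChainGraph-singleton : ∀ x y → ChainGraph ｛ x ｝ ｛ y ｝
  ChainGraph-singleton x y = 2 , s , t , rep
    where
    s t : Fin n → Fin 2
    s _ = if adj G x y then zero else suc zero
    t _ = zero
    rep : ∀ {a b} → x ≡ a → y ≡ b → (adj G a b ≡ true) ⇔ (s a ≤ᶠ t b)
    rep refl refl with adj G x y
    ... | true  = mk⇔ (λ _ → ℕ.z≤n) (λ _ → refl)
    ... | false = mk⇔ (λ ()) (λ ())

  ChainGraph-swap : ∀ {A B} → ChainGraph A B → ChainGraph B A
  ChainGraph-swap {A} {B} (k , s , t , rep) = k , opposite ∘ t , opposite ∘ s , rep′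
    where
    rep′ : ∀ {b a} → B b → A a → (adj G b a ≡ true) ⇔ (opposite (t b) ≤ᶠ opposite (s a))
    rep′ {b} {a} b∈B a∈A rewrite Graph.sym G b a = ⇔.trans (rep a∈A b∈B) ≤⇔opposite-≥

  ChainGraph-∪-complete : ∀ {A B Y} → Decidable A → Homogeneous true B Y →
    ChainGraph A Y → ChainGraph (A ∪ B) Y
  ChainGraph-∪-complete {A} {B} {Y} A? B⇉Y (k , s , t , rep) = suc k , s′ , suc ∘ t , rep′
    where
    s′ : Fin n → Fin (suc k)
    s′ u = if does (A? u) then suc (s u) else zero
    rep′ : ∀ {u v} → (A ∪ B) u → Y v → (adj G u v ≡ true) ⇔ (s′ u ≤ᶠ suc (t v))
    rep′ {u} u∈A∪B v∈Y with A? u | u∈A∪B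
    ... | yes u∈A | _        = mk⇔ (ℕ.s≤s ∘ to (rep u∈A v∈Y)) (from (rep u∈A v∈Y) ∘ ℕ.s≤s⁻¹)
    ... | no  u∉A | inj₁ u∈A = ⊥-elim (u∉A u∈A)
    ... | no  _   | inj₂ u∈B rewrite B⇉Y u∈B v∈Y = mk⇔ (λ _ → ℕ.z≤n) (λ _ → refl)

  ChainGraph-∪-anticompleteʳ : ∀ {X B C} → Decidable B → Homogeneous false X C →
    ChainGraph X B → ChainGraph X (B ∪ C)
  ChainGraph-∪-anticompleteʳ {X} {B} {C} B? X⇉C (k , s , t , rep) = suc k , suc ∘ s , t′ , rep′
    where
    t′ : Fin n → Fin (suc k)
    t′ v = if does (B? v) then suc (t v) else zero
    rep′ : ∀ {u v} → X u → (B ∪ C) v → (adj G u v ≡ true) ⇔ (suc (s u) ≤ᶠ t′ v)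
    rep′ {v = v} u∈X v∈B∪C with B? v | v∈B∪C
    ... | yes v∈B | _        = mk⇔ (ℕ.s≤s ∘ to (rep u∈X v∈B)) (from (rep u∈X v∈B) ∘ ℕ.s≤s⁻¹)
    ... | no  v∉B | inj₁ v∈B = ⊥-elim (v∉B v∈B)
    ... | no  _   | inj₂ v∈C rewrite X⇉C u∈X v∈C = mk⇔ (λ ()) (λ ())

  ChainGraph-∪-homogeneous : ∀ {c A B Y} → Decidable A → Homogeneous c B Y →
    ChainGraph A Y → ChainGraph (A ∪ B) Y
  ChainGraph-∪-homogeneous {true}  A? B⇉Y = ChainGraph-∪-complete A? B⇉Y
  ChainGraph-∪-homogeneous {false} A? B⇉Y =
    ChainGraph-swap ∘ ChainGraph-∪-anticompleteʳ A? (Homogeneous-sym B⇉Y) ∘ ChainGraph-swap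

  ChainGraph⇒PartialHalfGraph : ∀ {A B} → ChainGraph A B → PartialHalfGraph G A B
  ChainGraph⇒PartialHalfGraph (k , s , t , rep) =
    k ℕ.* 2 ℕ.* n , (λ a → leftCode (s a) a) , (λ b → rightCode (t b) b) ,
    (λ a a′ _ _ → leftCode-injectiveʳ {i = s a} {s a′}) ,
    (λ b b′ _ _ → rightCode-injectiveʳ {i = t b} {t b′}) ,
    λ a b a∈A b∈B → ⇔.trans (rep a∈A b∈B) (≤⇔leftCode≤rightCode a b)

  Part : ∀ {m} → (Fin n → Fin m) → Fin m → Pred (Fin n) 0ℓ
  Part p X u = p u ≡ X

  PairwiseChain : ∀ {m} → (Fin n → Fin m) → Set
  PairwiseChain {m} p = ∀ (X Y : Fin m) → X ≢ Y → ChainGraph (Part p X) (Part p Y)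

  injective⇒PairwiseChain : ∀ {m} {p : Fin n → Fin m} → IsPartition m p →
    (∀ u v → p u ≡ p v → u ≡ v) → PairwiseChain p
  injective⇒PairwiseChain {p = p} surj inj X Y _ with surj X | surj Y
  ... | x , refl | y , refl = ChainGraph-⊆ (λ {u} pu≡px → inj x u (sym pu≡px))
                                           (λ {v} pv≡py → inj y v (sym pv≡py))
                                           (ChainGraph-singleton x y)

  redEdge? : ∀ {m} (p : Fin n → Fin m) X Y → Dec (RedEdge G p X Y)
  redEdge? p X Y = ¬? (X ≟ᶠ Y) ×-dec edgeWith? true ×-dec edgeWith? false
    where
    edgeWith? : ∀ c → Dec (Σ (Fin n) λ u → Σ (Fin n) λ v → p u ≡ X × p v ≡ Y × adj G u v ≡ c)
    edgeWith? c = any? λ u → any? λ v → p u ≟ᶠ X ×-dec p v ≟ᶠ Y ×-dec adj G u v ≟ᵇ c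

  ¬RedEdge⇒Homogeneous : ∀ {m} {p : Fin n → Fin m} {X Y u v} → X ≢ Y → ¬ RedEdge G p X Y →
    p u ≡ X → p v ≡ Y → Homogeneous (adj G u v) (Part p X) (Part p Y)
  ¬RedEdge⇒Homogeneous {u = u} {v} X≢Y ¬red pu pv {u′} {v′} pu′ pv′
    with adj G u′ v′ in e′ | adj G u v in e
  ... | true  | true  = refl
  ... | false | false = refl
  ... | true  | false = ⊥-elim (¬red (X≢Y , (u′ , v′ , pu′ , pv′ , e′) , (u , v , pu , pv , e)))
  ... | false | true  = ⊥-elim (¬red (X≢Y , (u , v , pu , pv , e) , (u′ , v′ , pu′ , pv′ , e′)))

  PairwiseChain-∪ : ∀ {m} {p : Fin n → Fin m} → IsPartition m p → PairwiseChain p →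
    ∀ {A B y} → A ≢ p y → B ≢ p y → ¬ RedEdge G p (p y) B →
    ChainGraph (Part p A ∪ Part p B) (Part p (p y))
  PairwiseChain-∪ {p = p} surj chain {A} {B} {y} A≢Y B≢Y ¬red with surj B
  ... | _ , refl = ChainGraph-∪-homogeneous (λ u → p u ≟ᶠ A)
    (Homogeneous-sym (¬RedEdge⇒Homogeneous (B≢Y ∘ sym) ¬red refl refl))
    (chain A (p y) A≢Y)

  PairwiseChain-merge : ∀ {m} {p : Fin n → Fin (suc m)} {q : Fin n → Fin m} →
    IsPartition (suc m) p → IsPartition m q → RedDegreeAtMostOne G p → MergeOf p q →
    PairwiseChain p → PairwiseChain q
  PairwiseChain-merge {p = p} {q} p-surj q-surj redDeg≤1 (a , b , a≢b , merge) chain = chain-q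
    where
    Merged : Pred (Fin n) 0ℓ
    Merged = Part p a ∪ Part p b

    merged? : Decidable Merged
    merged? u = p u ≟ᶠ a ⊎-dec p u ≟ᶠ b

    Part-q-unmerged : ∀ {x} → ¬ Merged x → Part q (q x) ⊆ Part p (p x)
    Part-q-unmerged {x} x∉M {u} qu≡qx with to (merge u x) qu≡qx
    ... | inj₁ pu≡px             = pu≡px
    ... | inj₂ (inj₁ (_ , px≡b)) = ⊥-elim (x∉M (inj₂ px≡b))
    ... | inj₂ (inj₂ (_ , px≡a)) = ⊥-elim (x∉M (inj₁ px≡a))

    Part-q-merged : ∀ {x} → Merged x → Part q (q x) ⊆ Merged
    Part-q-merged {x} x∈M {u} qu≡qx with to (merge u x) qu≡qx | x∈M
    ... | inj₁ pu≡px             | inj₁ px≡a = inj₁ (trans pu≡px px≡a)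
    ... | inj₁ pu≡px             | inj₂ px≡b = inj₂ (trans pu≡px px≡b)
    ... | inj₂ (inj₁ (pu≡a , _)) | _         = inj₁ pu≡a
    ... | inj₂ (inj₂ (pu≡b , _)) | _         = inj₂ pu≡b

    merged-same-part : ∀ {x y} → Merged x → Merged y → q x ≡ q y
    merged-same-part {x} {y} x∈M y∈M = from (merge x y) (same x∈M y∈M)
      where
      same : Merged x → Merged y →
        p x ≡ p y ⊎ (p x ≡ a × p y ≡ b) ⊎ (p x ≡ b × p y ≡ a)
      same (inj₁ px≡a) (inj₁ py≡a) = inj₁ (trans px≡a (sym py≡a))
      same (inj₁ px≡a) (inj₂ py≡b) = inj₂ (inj₁ (px≡a , py≡b))
      same (inj₂ px≡b) (inj₁ py≡a) = inj₂ (inj₂ (px≡b , py≡a))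
      same (inj₂ px≡b) (inj₂ py≡b) = inj₁ (trans px≡b (sym py≡b))

    a≢unmerged : ∀ {y} → ¬ Merged y → a ≢ p y
    a≢unmerged y∉M a≡py = y∉M (inj₁ (sym a≡py))

    b≢unmerged : ∀ {y} → ¬ Merged y → b ≢ p y
    b≢unmerged y∉M b≡py = y∉M (inj₂ (sym b≡py))

    Merged-chain : ∀ {y} → ¬ Merged y → ChainGraph Merged (Part p (p y))
    Merged-chain {y} y∉M with redEdge? p (p y) b
    ... | no ¬red-b = PairwiseChain-∪ p-surj chain (a≢unmerged y∉M) (b≢unmerged y∉M) ¬red-b
    ... | yes red-b = ChainGraph-⊆ Sum.swap id
      (PairwiseChain-∪ p-surj chain (b≢unmerged y∉M) (a≢unmerged y∉M)
        (λ red-a → a≢b (redDeg≤1 (p y) a b red-a red-b)))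

    merged×unmerged : ∀ {x y} → Merged x → ¬ Merged y → ChainGraph (Part q (q x)) (Part q (q y))
    merged×unmerged x∈M y∉M =
      ChainGraph-⊆ (Part-q-merged x∈M) (Part-q-unmerged y∉M) (Merged-chain y∉M)

    chain-q : PairwiseChain q
    chain-q X Y X≢Y with q-surj X | q-surj Y
    ... | x , refl | y , refl with merged? x | merged? y
    ... | yes x∈M | yes y∈M = ⊥-elim (X≢Y (merged-same-part x∈M y∈M))
    ... | yes x∈M | no  y∉M = merged×unmerged x∈M y∉M
    ... | no  x∉M | yes y∈M = ChainGraph-swap (merged×unmerged y∈M x∉M)
    ... | no  x∉M | no  y∉M = ChainGraph-⊆ (Part-q-unmerged x∉M) (Part-q-unmerged y∉M)
                                (chain (p x) (p y) (X≢Y ∘ from (merge x y) ∘ inj₁))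

  PairwiseChain-sequence : (S : PartitionSequence G) → WidthAtMostOne S →
    ∀ {i} → suc i ℕ.≤‴ n → PairwiseChain (part S i)
  PairwiseChain-sequence S W ℕ.≤‴-refl =
    injective⇒PairwiseChain (isPartition S _ ℕ.≤-refl) (singletons S)
  PairwiseChain-sequence S W {i} (ℕ.≤‴-step i+1<‴n) =
    PairwiseChain-merge (isPartition S _ i+1<n) (isPartition S _ (ℕ.<⇒≤ i+1<n)) (W _ i+1<n)
      (merges S _ i+1<n) (PairwiseChain-sequence S W i+1<‴n)
    where
    i+1<n : suc (suc i) ≤ n
    i+1<n = ℕ.≤‴⇒≤ i+1<‴n

lemma5p2 : ∀ (n : ℕ) (G : Graph n) (S : PartitionSequence G) → WidthAtMostOne S →
    ∀ (i : ℕ) → suc i ≤ n → ∀ (P Q : Fin (suc i)) → P ≢ Q →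
    PartialHalfGraph G (λ u → part S i u ≡ P) (λ u → part S i u ≡ Q)
lemma5p2 n G S W i i<n P Q P≢Q =
  ChainGraph⇒PartialHalfGraph G (PairwiseChain-sequence G S W (ℕ.≤⇒≤‴ i<n) P Q P≢Q)
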